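{- Let $S = (s_0, \ldots, s_{k-1})$ be any finite (possibly empty) sequence of positive integers and let $x \geq 1$ be an integer. Let $G$ be the \textsc{Tower Nim} position $(s_0, \ldots, s_{k-1}, 1, x)$. Then: if $x = 1$, the nim-value of $G$ is either $0$ or $*$ (i.e. its Grundy value is $0$ or $1$); if $x \geq 2$, then $G = *x$ (its Grundy value is $x$).
   Context: \textsc{Tower Nim} is an impartial combinatorial game played under normal play (a player unable to move loses). A position is a finite list $L = (a_0, a_1, \ldots, a_n)$ of positive integers (a stack of heaps; $a_n$ is the top heap); the empty list is the terminal position. The options of $L$ are: $(a_0, \ldots, a_{n-1})$ (remove the whole top heap), and $(a_0, \ldots, a_{n-1}, b)$ for every integer $b$ with $1 \leq b < a_n$. The nim-value (Grundy value) of a position is the mex of the Grundy values of its options; $*x$ denotes the nimber with Grundy value $x$, and $*$ means $*1$. -}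

module Defs where

open import Data.Nat using (ℕ; zero; suc; _≟_)
open import Data.List using (List; []; _∷_; _++_; [_]; reverse)
open import Data.Bool using (Bool; true; false; if_then_else_)
open import Relation.Nullary.Decidable using (⌊_⌋)

-- Tower Nim positions are lists of positive heap sizes.
-- Internally a position is stored TOP-FIRST: (t ∷ rest) has top heap t.
-- The paper's notation (a_0, …, a_n) (bottom-first) corresponds to
-- `reverse` of that; see `Position` / `grundy` below.

elem : ℕ → List ℕ → Bool
elem n [] = false
elem n (m ∷ ms) = if ⌊ n ≟ m ⌋ then true else elem n ms

-- mex by bounded search: least n ≥ k (searching at most `fuel` steps)
-- not in xs; with fuel = length xs + 1 starting at 0 it is the true mex.
mexFrom : ℕ → ℕ → List ℕ → ℕ
mexFrom zero k xs = k
mexFrom (suc f) k xs = if elem k xs then mexFrom f (suc k) xs else k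

len : List ℕ → ℕ
len [] = zero
len (_ ∷ xs) = suc (len xs)

mex : List ℕ → ℕ
mex xs = mexFrom (suc (len xs)) zero xs

-- Grundy value of a top-first position (t ∷ rest): its options are
-- rest, and (b ∷ rest) for 1 ≤ b < t.
grundyTF : List ℕ → ℕ
lowerVals : ℕ → List ℕ → List ℕ
topVal : ℕ → List ℕ → ℕ

grundyTF [] = zero
grundyTF (t ∷ rest) = topVal t rest

topVal t rest = mex (grundyTF rest ∷ lowerVals t rest)

lowerVals zero rest = []
lowerVals (suc zero) rest = []
lowerVals (suc (suc b)) rest = topVal (suc b) rest ∷ lowerVals (suc b) rest

grundy : List ℕ → ℕ
grundy L = grundyTF (reverse L)

module Submission where

-- Put r = reverse S, so the position is x on top of 1 on top of r. The heap 1
-- has the single option r, hence value h = mex {g(r)} ∈ {0, 1}. With x on top,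
-- the options are r (value h) and b on top of 1 ∷ r for 1 ≤ b < x. For x = 1 the
-- value is mex {h} ∈ {0, 1}, the complement of h. For x ≥ 2, inductively the
-- option values are h, 1 − h, 2, …, x − 1, i.e. exactly {0, …, x − 1}, so the
-- value is x.

open import Defs
open import Data.Nat using (ℕ; _≤_; _<_; suc; zero; _+_; _≟_; z≤n; s≤s)
open import Data.Nat.Properties
  using (≤-refl; ≤-reflexive; <-irrefl; <⇒≱; m<n⇒m<1+n; m<1+n⇒m<n∨m≡n; m≤n⇒m<n∨m≡n; +-suc; +-identityʳ)
open import Data.List using (List; _++_; _∷_; []; [_]; reverse)
open import Data.List.Properties using (reverse-++)
open import Data.List.Membership.Propositional using (_∈_; _∉_)
open import Data.List.Relation.Unary.Any using (here; there; tail)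
open import Data.List.Relation.Unary.All as All using (All; _∷_; [])
open import Data.Sum using (_⊎_; inj₁; inj₂)
open import Data.Product using (_×_; _,_)
open import Data.Bool using (true; false)
open import Data.Empty using (⊥-elim)
open import Relation.Nullary.Decidable using (yes; no)
open import Relation.Binary.PropositionalEquality using (_≡_; refl; sym; cong; subst)

elem-complete : ∀ {j xs} → j ∈ xs → elem j xs ≡ true
elem-complete {j} {m ∷ _} j∈ with j ≟ m
... | yes _ = refl
... | no j≢m = elem-complete (tail j≢m j∈)

elem-sound : ∀ {j} xs → j ∉ xs → elem j xs ≡ false
elem-sound [] _ = refl
elem-sound {j} (m ∷ ms) j∉ with j ≟ m
... | yes refl = ⊥-elim (j∉ (here refl))
... | no _ = elem-sound ms (λ j∈ → j∉ (there j∈))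

record Enumerates (n : ℕ) (xs : List ℕ) : Set where
  field
    complete : ∀ {j} → j < n → j ∈ xs
    bounded : All (_< n) xs

  absent : n ∉ xs
  absent n∈ = <-irrefl refl (All.lookup bounded n∈)

open Enumerates

mexFrom-enumerates : ∀ {n xs} → Enumerates n xs →
  ∀ f k → k ≤ n → n < f + k → mexFrom f k xs ≡ n
mexFrom-enumerates e zero k k≤n n<k = ⊥-elim (<⇒≱ n<k k≤n)
mexFrom-enumerates {n} {xs} e (suc f) k k≤n n<f+k with m≤n⇒m<n∨m≡n k≤n
... | inj₂ refl rewrite elem-sound xs (absent e) = refl
... | inj₁ k<n rewrite elem-complete (complete e k<n) =
  mexFrom-enumerates e f (suc k) k<n (subst (n <_) (sym (+-suc f k)) n<f+k)

mex-enumerates : ∀ {n xs} → Enumerates n xs → n ≤ len xs → mex xs ≡ n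
mex-enumerates {n} {xs} e n≤len =
  mexFrom-enumerates e (suc (len xs)) 0 z≤n (subst (n <_) (sym (+-identityʳ (suc (len xs)))) (s≤s n≤len))

enumerates-insert : ∀ {n a xs} → Enumerates n (a ∷ xs) → Enumerates (suc n) (a ∷ n ∷ xs)
enumerates-insert {n} {a} {xs} e = record { complete = complete′ ; bounded = bounded′ }
  where
  complete′ : ∀ {j} → j < suc n → j ∈ a ∷ n ∷ xs
  complete′ j<1+n with m<1+n⇒m<n∨m≡n j<1+n
  ... | inj₂ refl = there (here refl)
  ... | inj₁ j<n with complete e j<n
  ...   | here j≡a = here j≡a
  ...   | there j∈xs = there (there j∈xs)

  bounded′ : All (_< suc n) (a ∷ n ∷ xs)
  bounded′ with bounded e
  ... | a<n ∷ xs<n = m<n⇒m<1+n a<n ∷ ≤-refl ∷ All.map m<n⇒m<1+n xs<n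

mex-singleton : ∀ a → mex [ a ] ≡ 0 ⊎ mex [ a ] ≡ 1
mex-singleton zero = inj₂ refl
mex-singleton (suc a) = inj₁ refl

enumerates-binary : ∀ {h} → h ≡ 0 ⊎ h ≡ 1 → Enumerates 2 (h ∷ mex [ h ] ∷ [])
enumerates-binary (inj₁ refl) = record
  { complete = λ { (s≤s z≤n) → here refl ; (s≤s (s≤s z≤n)) → there (here refl) }
  ; bounded = s≤s z≤n ∷ s≤s (s≤s z≤n) ∷ [] }
enumerates-binary (inj₂ refl) = record
  { complete = λ { (s≤s z≤n) → there (here refl) ; (s≤s (s≤s z≤n)) → here refl }
  ; bounded = s≤s (s≤s z≤n) ∷ s≤s z≤n ∷ [] }

optionValues : ℕ → List ℕ → List ℕ
optionValues t R = grundyTF R ∷ lowerVals t R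

len-optionValues : ∀ n R → len (optionValues (suc n) R) ≡ suc n
len-optionValues zero R = refl
len-optionValues (suc n) R = cong suc (len-optionValues n R)

module _ (R : List ℕ) (binary : grundyTF R ≡ 0 ⊎ grundyTF R ≡ 1) where

  enumerates-optionValues : ∀ m → Enumerates (suc (suc m)) (optionValues (suc (suc m)) R)
  topVal-tower : ∀ m → topVal (suc (suc m)) R ≡ suc (suc m)

  enumerates-optionValues zero = enumerates-binary binary
  enumerates-optionValues (suc m) =
    subst (λ v → Enumerates (suc (suc (suc m))) (grundyTF R ∷ v ∷ lowerVals (suc (suc m)) R))
      (sym (topVal-tower m))
      (enumerates-insert (enumerates-optionValues m))

  topVal-tower m =
    mex-enumerates (enumerates-optionValues m) (≤-reflexive (sym (len-optionValues (suc m) R)))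

mainTheorem2 : (S : List ℕ) → All (λ s → 1 ≤ s) S → (x : ℕ) → 1 ≤ x →
    ((x ≡ 1 → (grundy (S ++ 1 ∷ x ∷ []) ≡ 0 ⊎ grundy (S ++ 1 ∷ x ∷ []) ≡ 1))
    × (2 ≤ x → grundy (S ++ 1 ∷ x ∷ []) ≡ x))
mainTheorem2 S _ x _ = singleHeap , tallHeap
  where
  r : List ℕ
  r = reverse S

  topFirst : grundy (S ++ 1 ∷ x ∷ []) ≡ topVal x (1 ∷ r)
  topFirst = cong grundyTF (reverse-++ S (1 ∷ x ∷ []))

  singleHeap : x ≡ 1 → grundy (S ++ 1 ∷ x ∷ []) ≡ 0 ⊎ grundy (S ++ 1 ∷ x ∷ []) ≡ 1
  singleHeap refl rewrite topFirst = mex-singleton (grundyTF (1 ∷ r))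

  tallHeap : 2 ≤ x → grundy (S ++ 1 ∷ x ∷ []) ≡ x
  tallHeap (s≤s (s≤s {n = m} _)) rewrite topFirst = topVal-tower (1 ∷ r) (mex-singleton (grundyTF r)) m
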